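{- If a tournament $T$ has two distinct minimal $\tau$-retentive sets $R_1$ and $R_2$, then $R_1\cap R_2=\emptyset$.
   Context: A tournament $T$ consists of a finite vertex set $V(T)$ and an asymmetric, complete binary relation $\succ$ on $V(T)$ ($x$ dominates $y$ if $x\succ y$). For $v\in V(T)$ let $N^-_T(v)=\{u: u\succ v\}$; for $B\subseteq V(T)$, $T[B]$ is the induced subtournament. The tournament equilibrium set $\tau$ is defined recursively: a nonempty $A\subseteq V(T)$ is $\tau$-retentive if for every $x\in A$ with $N^-_T(x)\neq\emptyset$, $\tau(T[N^-_T(x)])\subseteq A$; $A$ is a minimal $\tau$-retentive set if no $\tau$-retentive set of $T$ is a proper subset of $A$; $\tau(T)$ is the union of all minimal $\tau$-retentive sets of $T$. -}

module Defs where

open import Data.Nat using (ℕ; zero; suc)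
open import Data.Fin using (Fin)
open import Data.Bool using (_∧_)
open import Data.Vec using (tabulate; lookup)
open import Data.Product using (_×_; ∃)
open import Data.Sum using (_⊎_)
open import Data.Empty using (⊥)
open import Relation.Nullary using (¬_)
open import Relation.Nullary.Decidable using (⌊_⌋)
open import Relation.Binary.PropositionalEquality using (_≢_)
open import Data.Fin.Subset using (Subset; _∈_; _⊆_; _⊂_; ⊤; Nonempty)

-- The relation is taken decidable (a finite relation; harmless classically)
-- so that vertex subsets can be represented as Data.Fin.Subset.
record Tournament (n : ℕ) : Set₁ where
  field
    _≻_      : Fin n → Fin n → Set
    _≻?_     : ∀ x y → Relation.Nullary.Dec (x ≻ y)
    asym     : ∀ {x y} → x ≻ y → ¬ (y ≻ x)
    complete : ∀ {x y} → x ≢ y → (x ≻ y) ⊎ (y ≻ x)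

module _ {n : ℕ} (T : Tournament n) where
  open Tournament T

  Nin : Subset n → Fin n → Subset n
  Nin B x = tabulate (λ y → lookup B y ∧ ⌊ y ≻? x ⌋)

  -- τ(T[B]) (a set of vertices of T[B], i.e. a subset of B), defined by
  -- recursion on a fuel k bounding |B|.
  -- τ-retentive sets of T[B] (using τ at fuel k for the inner calls),
  -- minimal τ-retentive sets, and τ at fuel suc k = their union.
  mutual
    τ-Retentive : ℕ → Subset n → Subset n → Set
    τ-Retentive k B A =
      A ⊆ B × Nonempty A ×
      (∀ x → x ∈ A → Nonempty (Nin B x) → ∀ y → τₖ k (Nin B x) y → y ∈ A)

    τ-MinRetentive : ℕ → Subset n → Subset n → Set
    τ-MinRetentive k B A =
      τ-Retentive k B A × (∀ A′ → τ-Retentive k B A′ → ¬ (A′ ⊂ A))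

    τₖ : ℕ → Subset n → Fin n → Set
    τₖ zero    B x = ⊥
    τₖ (suc k) B x = ∃ λ (A : Subset n) → τ-MinRetentive k B A × x ∈ A

  -- τ(T[B]) for B ⊆ V(T): fuel n suffices since |B| ≤ n and each recursive
  -- call is on the strictly smaller set N⁻_B(x) (x ∉ N⁻_B(x)).
  τ : Subset n → Fin n → Set
  τ = τₖ n

  IsRetentive : Subset n → Set
  IsRetentive = τ-Retentive n ⊤

  IsMinimalRetentive : Subset n → Set
  IsMinimalRetentive = τ-MinRetentive n ⊤

-- Retentiveness is closed under nonempty intersections, so a minimal
-- retentive set that meets another retentive set is contained in it; two
-- minimal retentive sets that meet are therefore contained in each other.
module Submission where

open import Defs
open import Data.Nat using (ℕ)
open import Data.Empty using (⊥-elim)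
open import Data.Product using (_,_; proj₁)
open import Data.Fin.Subset using (Subset; _∈_; _∩_; _⊆_; Nonempty; Empty)
open import Data.Fin.Subset.Properties
  using (_∈?_; p∩q⊆p; p∩q⊆q; x∈p∩q⁺; x∈p∩q⁻; ∩-comm; ⊆-antisym)
open import Relation.Binary.PropositionalEquality using (_≢_; subst)
open import Relation.Nullary using (yes; no)

module _ {n : ℕ} (T : Tournament n) {k : ℕ} {B : Subset n} where

  ∩-τ-Retentive : ∀ {A₁ A₂} → τ-Retentive T k B A₁ → τ-Retentive T k B A₂ →
    Nonempty (A₁ ∩ A₂) → τ-Retentive T k B (A₁ ∩ A₂)
  ∩-τ-Retentive {A₁} {A₂} (A₁⊆B , _ , closed₁) (_ , _ , closed₂) meet =
    (λ x∈A₁∩A₂ → A₁⊆B (p∩q⊆p A₁ A₂ x∈A₁∩A₂)) , meet , closed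
    where
    closed : ∀ x → x ∈ A₁ ∩ A₂ → Nonempty (Nin T B x) →
      ∀ y → τₖ T k (Nin T B x) y → y ∈ A₁ ∩ A₂
    closed x x∈A₁∩A₂ nonempty y y∈τ with x∈p∩q⁻ A₁ A₂ x∈A₁∩A₂
    ... | x∈A₁ , x∈A₂ =
      x∈p∩q⁺ (closed₁ x x∈A₁ nonempty y y∈τ , closed₂ x x∈A₂ nonempty y y∈τ)

  τ-MinRetentive⇒⊆ : ∀ {R A} → τ-MinRetentive T k B R → τ-Retentive T k B A →
    Nonempty (R ∩ A) → R ⊆ A
  τ-MinRetentive⇒⊆ {R} {A} (retentive , minimal) A-retentive meet {y} y∈R
    with y ∈? A
  ... | yes y∈A = y∈A
  ... | no  y∉A = ⊥-elim (minimal (R ∩ A)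
          (∩-τ-Retentive retentive A-retentive meet)
          (p∩q⊆p R A , y , y∈R , λ y∈R∩A → y∉A (p∩q⊆q R A y∈R∩A)))

lemma12 : ∀ {n : ℕ} (T : Tournament n) (R₁ R₂ : Subset n) →
    IsMinimalRetentive T R₁ → IsMinimalRetentive T R₂ →
    R₁ ≢ R₂ → Empty (R₁ ∩ R₂)
lemma12 T R₁ R₂ min₁ min₂ R₁≢R₂ meet = R₁≢R₂ (⊆-antisym
  (τ-MinRetentive⇒⊆ T min₁ (proj₁ min₂) meet)
  (τ-MinRetentive⇒⊆ T min₂ (proj₁ min₁) (subst Nonempty (∩-comm R₁ R₂) meet)))
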